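{- Let $t\ge 3$ be an integer. Then $\rho(\mathrm{GREEDY}, K_{1,t}\text{ -FREE}) = t-1$.
   Context: Online dominating set model: an input is a finite, connected, simple, undirected graph $G=(V,E)$ together with an ordering $v_1,\dots,v_n$ of $V$ chosen by an adversary such that for every $i$ the subgraph induced on $\{v_1,\dots,v_i\}$ is connected. At step $i$, $v_i$ is revealed together with its entire closed neighbourhood $N[v_i]$, and the algorithm irrevocably decides whether to select $v_i$; the selected set must dominate $G$. $ALG$ is the number of selected vertices, $OPT$ the minimum dominating set size; $\rho(ALG,\mathrm{CLASS})$ is the infimum of all $c$ with $\limsup_{OPT\to\infty} ALG/OPT\le c$ over inputs with graph in CLASS. A graph is $K_{1,t}$-free if it has no induced subgraph isomorphic to $K_{1,t}$. Notation: $R_i=\{v_1,\dots,v_i\}$, $V_i=N[R_i]$; $S_i$ = vertices among $v_1,\dots,v_i$ selected, $S_0=\emptyset$; $D_i=N[S_i]$; $U_i=V_i\setminus D_{i-1}$. The algorithm GREEDY selects $v_i$ if and only if $v_i\in U_i$ (i.e., $v_i$ is not dominated by previously selected vertices). -}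

module Defs where

open import Data.Nat using (ℕ; zero; suc; _+_; _*_; _∸_; _≤_; _<_)
open import Data.Bool using (Bool; true; false; if_then_else_; _∧_; _∨_; T)
open import Data.Fin using (Fin; toℕ; _≟_)
open import Data.Fin.Subset using (Subset; ⊥; _∈_; _∉_; ∣_∣)
open import Data.Vec using (_[_]≔_; lookup)
open import Data.List using (List; foldl; allFin)
open import Data.Bool.ListAction using (any)
open import Data.Product using (Σ; ∃; _×_; _,_)
open import Relation.Nullary using (¬_; does)
open import Relation.Binary.PropositionalEquality using (_≡_)
open import Function.Definitions using (Injective)

record Graph (n : ℕ) : Set where
  field
    adj   : Fin n → Fin n → Bool
    sym   : ∀ u v → adj u v ≡ adj v u
    irrefl : ∀ u → adj u u ≡ false

open Graph public

Adj : ∀ {n} → Graph n → Fin n → Fin n → Set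
Adj G u v = T (adj G u v)

InClosedNbhd : ∀ {n} → Graph n → Fin n → Fin n → Set
InClosedNbhd G u v = u ≡ v Data.Sum.⊎ Adj G u v
  where import Data.Sum

data PathIn {n : ℕ} (G : Graph n) (P : Fin n → Set) : Fin n → Fin n → Set where
  here : ∀ {u} → P u → PathIn G P u u
  step : ∀ {u w v} → P u → Adj G u w → PathIn G P w v → PathIn G P u v

InducedConnected : ∀ {n} → Graph n → (Fin n → Set) → Set
InducedConnected G P = ∀ u v → P u → P v → PathIn G P u v

-- The input order is v_1 = 0, v_2 = 1, ..., v_n = n-1 (the natural order of Fin n).
-- Prefix R_i = {v_1,...,v_i} = {x | toℕ x < i}.
Prefix : ∀ {n} → ℕ → Fin n → Set
Prefix i x = toℕ x < i

-- Adversary constraint: every prefix induces a connected subgraph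
-- (for i = n this says G itself is connected).
ValidOrder : ∀ {n} → Graph n → Set
ValidOrder {n} G = ∀ i → i ≤ n → InducedConnected G (Prefix i)

K1tFree : ℕ → ∀ {n} → Graph n → Set
K1tFree t {n} G =
  ¬ (Σ (Fin n) λ c → Σ (Fin t → Fin n) λ ℓ →
       Injective _≡_ _≡_ ℓ
     × (∀ i → Adj G c (ℓ i))
     × (∀ i j → ¬ i ≡ j → ¬ Adj G (ℓ i) (ℓ j)))

Dominating : ∀ {n} → Graph n → Subset n → Set
Dominating {n} G D = ∀ v → Σ (Fin n) λ u → u ∈ D × InClosedNbhd G u v

IsOPT : ∀ {n} → Graph n → ℕ → Set
IsOPT G k = (Σ _ λ D → Dominating G D × ∣ D ∣ ≡ k)
          × (∀ D → Dominating G D → k ≤ ∣ D ∣)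

dominatedB : ∀ {n} → Graph n → Subset n → Fin n → Bool
dominatedB {n} G S v =
  any (λ u → lookup S u ∧ (does (u ≟ v) ∨ adj G u v)) (allFin n)

greedy : ∀ {n} → Graph n → Subset n
greedy {n} G = foldl (λ S v → if dominatedB G S v then S else (S [ v ]≔ true)) ⊥ (allFin n)

ALG : ∀ {n} → Graph n → ℕ
ALG G = ∣ greedy G ∣

-- GREEDY only selects a vertex that no earlier selected vertex dominates, so its output is an
-- independent set.  In a K_{1,t}-free graph a vertex u dominates at most t − 1 vertices of an
-- independent set S: either u ∈ S, and then it dominates only itself in S, or its neighbours in S
-- are the leaves of an induced star.  Charging every vertex of S to a vertex of a minimum
-- dominating set therefore gives ALG ≤ (t − 1) OPT.
--
-- For the lower bound, chain k gadgets, each a triangle entry–centre–exit with t − 2 leaves on its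
-- centre, joining the exit of each gadget to the entry of the next, and reveal them gadget by
-- gadget.  GREEDY selects every entry and every leaf, t − 1 vertices per gadget, while the k
-- centres dominate the graph and the pairwise disjoint closed neighbourhoods of one leaf per gadget
-- force OPT ≥ k.  Every neighbourhood is covered by t − 1 cliques, so the graph is K_{1,t}-free.
module Submission where

open import Defs renaming (sym to adj-sym)
import Algebra.Properties.CommutativeMonoid.Sum as FinSum
open import Data.Bool using (Bool; true; false; T; _∧_; if_then_else_)
open import Data.Bool.Properties using (T-≡; T-∧; T-∨; ¬-not; ∨-comm)
open import Data.Empty using (⊥; ⊥-elim)
open import Data.Fin using (Fin; zero; suc; toℕ; _≟_; _<_; punchIn; combine; remQuot; inject₁)
open import Data.Fin.Induction using (<-wellFounded)
open import Data.Fin.Properties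
  using (suc-injective; 0≢1+n; toℕ-injective; toℕ<n; toℕ-inject₁; <-cmp; <⇒≢; ≤̄⇒inject₁<; any?;
         pigeonhole; punchInᵢ≢i; remQuot-combine; combine-remQuot; toℕ-combine; combine-monoˡ-<;
         combine-injectiveˡ; combine-injectiveʳ)
open import Data.Fin.Subset using (Subset; ∣_∣; _∈_) renaming (⊥ to ∅)
open import Data.List as List using (foldl; allFin)
open import Data.List.Relation.Unary.Any using (satisfied)
open import Data.List.Relation.Unary.Any.Properties using (any⁺; any⁻; tabulate⁺)
open import Data.Nat as ℕ using (ℕ; zero; suc; _+_; _*_; _∸_; _≤_; z≤n; s≤s; z<s; s<s)
open import Data.Nat.Properties
  using (+-0-commutativeMonoid; ≤-refl; ≤-antisym; <-trans; <-≤-trans; <⇒≤; <-irrefl; n≮0; ≮⇒≥; _<?_;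
         n<1+n; m<n⇒m<1+n; m<1+n⇒m<n∨m≡n; m≤m+n; +-suc; +-identityʳ; *-identityʳ; *-distribʳ-+;
         +-mono-≤; +-monoʳ-<; *-monoʳ-≤; module ≤-Reasoning)
open import Data.Nat.Tactic.RingSolver using (solve-∀)
open import Data.Product using (Σ; ∃; _×_; _,_; proj₁; proj₂; uncurry)
open import Data.Sum as Sum using (_⊎_; inj₁; inj₂; [_,_])
open import Data.Unit using (tt)
open import Data.Vec as Vec using (lookup; tabulate; _[_]≔_)
open import Data.Vec.Functional using (_∷_)
open import Data.Vec.Properties
  using ([]=⇒lookup; lookup⇒[]=; lookup∘tabulate; lookup∘update; lookup∘update′; lookup-replicate)
open import Function using (id; _∘_; _∘₂_; _⇔_; mk⇔; Equivalence)
open import Function.Definitions using (Injective)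
open import Induction.WellFounded using (Acc; acc)
open import Relation.Binary.Definitions using (tri<; tri≈; tri>)
open import Relation.Binary.PropositionalEquality
  using (_≡_; refl; sym; trans; cong; cong₂; subst; subst₂; module ≡-Reasoning)
open import Relation.Nullary using (¬_; Dec; yes; no; does)
open import Relation.Nullary.Decidable using (dec-true; dec-false; map′; _⊎-dec_)

open FinSum +-0-commutativeMonoid using (sum; sum-syntax; ∑-comm; sum-cong-≗; sum-replicate-zero)
open Equivalence using (to; from)

does-sound : ∀ {A : Set} (a? : Dec A) → T (does a?) → A
does-sound (yes a) _ = a

does-complete : ∀ {A : Set} (a? : Dec A) → A → T (does a?)
does-complete a? a = T-≡ .from (dec-true a? a)

-- Counting

𝟙 : Bool → ℕ
𝟙 true  = 1
𝟙 false = 0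

count : ∀ {n} → (Fin n → Bool) → ℕ
count p = sum (𝟙 ∘ p)

fibre : ∀ {a b} → (Fin a → Bool) → (Fin a → Fin b) → Fin b → Fin a → Bool
fibre p f u v = p v ∧ does (f v ≟ u)

fibre⁻ : ∀ {a b} {p : Fin a → Bool} {f : Fin a → Fin b} {u v} → T (fibre p f u v) → T (p v) × f v ≡ u
fibre⁻ {f = f} {u} {v} v∈fibre = let pv , fv≡u = T-∧ .to v∈fibre in pv , does-sound (f v ≟ u) fv≡u

∣∣≡count : ∀ {n} (S : Subset n) → ∣ S ∣ ≡ count (lookup S)
∣∣≡count Vec.[]          = refl
∣∣≡count (true  Vec.∷ S) = cong suc (∣∣≡count S)
∣∣≡count (false Vec.∷ S) = ∣∣≡count S

count-true : ∀ m → count {m} (λ _ → true) ≡ m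
count-true zero    = refl
count-true (suc m) = cong suc (count-true m)

sum-mono-≤ : ∀ {n} {f g : Fin n → ℕ} → (∀ i → f i ≤ g i) → sum f ≤ sum g
sum-mono-≤ {zero}  f≤g = z≤n
sum-mono-≤ {suc n} f≤g = +-mono-≤ (f≤g zero) (sum-mono-≤ (f≤g ∘ suc))

sum-*ʳ : ∀ {n} (f : Fin n → ℕ) c → sum (λ i → f i * c) ≡ sum f * c
sum-*ʳ {zero}  f c = refl
sum-*ʳ {suc n} f c = trans (cong (f zero * c +_) (sum-*ʳ (f ∘ suc) c)) (sym (*-distribʳ-+ c (f zero) _))

∑-𝟙-≟ : ∀ {n} b (x : Fin n) → ∑[ u < n ] 𝟙 (b ∧ does (x ≟ u)) ≡ 𝟙 b
∑-𝟙-≟ {n}     false x       = sum-replicate-zero n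
∑-𝟙-≟ {suc n} true  zero    = cong suc (sum-replicate-zero n)
∑-𝟙-≟ {suc n} true  (suc x) = ∑-𝟙-≟ true x

count-fibres : ∀ {a b} (p : Fin a → Bool) (f : Fin a → Fin b) → count p ≡ ∑[ u < b ] count (fibre p f u)
count-fibres {a} {b} p f = begin
  ∑[ v < a ] 𝟙 (p v)                         ≡⟨ sum-cong-≗ (λ v → sym (∑-𝟙-≟ (p v) (f v))) ⟩
  ∑[ v < a ] ∑[ u < b ] 𝟙 (fibre p f u v)    ≡⟨ ∑-comm (λ v u → 𝟙 (fibre p f u v)) ⟩
  ∑[ u < b ] ∑[ v < a ] 𝟙 (fibre p f u v)    ∎
  where open ≡-Reasoning

count-≥⇒injection : ∀ {n} (p : Fin n → Bool) c → c ≤ count p →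
                    Σ (Fin c → Fin n) λ ℓ → Injective _≡_ _≡_ ℓ × (∀ i → T (p (ℓ i)))
count-≥⇒injection {zero} p zero _ = (λ ()) , (λ { {()} }) , λ ()
count-≥⇒injection {suc n} p c c≤count with p zero in p₀
... | false with ℓ , ℓ-inj , ℓ∈p ← count-≥⇒injection (p ∘ suc) c c≤count =
  suc ∘ ℓ , ℓ-inj ∘ suc-injective , ℓ∈p
count-≥⇒injection {suc n} p zero    _          | true = (λ ()) , (λ { {()} }) , λ ()
count-≥⇒injection {suc n} p (suc c) (s≤s c≤count) | true
  with ℓ , ℓ-inj , ℓ∈p ← count-≥⇒injection (p ∘ suc) c c≤count = zero ∷ suc ∘ ℓ , ℓ′-inj , ℓ′∈p
  where
  ℓ′-inj : Injective _≡_ _≡_ (zero ∷ suc ∘ ℓ)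
  ℓ′-inj {zero}  {zero}  _ = refl
  ℓ′-inj {suc i} {suc j} e = cong suc (ℓ-inj (suc-injective e))
  ℓ′∈p : ∀ i → T (p ((zero ∷ suc ∘ ℓ) i))
  ℓ′∈p zero    = T-≡ .from p₀
  ℓ′∈p (suc i) = ℓ∈p i

¬injection⇒count-≤ : ∀ {n c} {p : Fin n → Bool} →
  (∀ (ℓ : Fin (suc c) → Fin n) → Injective _≡_ _≡_ ℓ → (∀ i → T (p (ℓ i))) → ⊥) → count p ≤ c
¬injection⇒count-≤ {c = c} {p} ¬injection with c <? count p
... | no  c≮count = ≮⇒≥ c≮count
... | yes c<count with ℓ , ℓ-inj , ℓ∈p ← count-≥⇒injection p (suc c) c<count =
  ⊥-elim (¬injection ℓ ℓ-inj ℓ∈p)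

count-≤1 : ∀ {n} {p : Fin n → Bool} → (∀ {u v} → T (p u) → T (p v) → u ≡ v) → count p ≤ 1
count-≤1 {p = p} unique =
  ¬injection⇒count-≤ {p = p} λ ℓ ℓ-inj ℓ∈p → 0≢1+n (ℓ-inj (unique (ℓ∈p zero) (ℓ∈p (suc zero))))

count-≤-fibres : ∀ {a b c} (p : Fin a → Bool) (q : Fin b → Bool) (f : Fin a → Fin b) →
                 (∀ v → T (p v) → T (q (f v))) → (∀ u → count (fibre p f u) ≤ c) → count p ≤ count q * c
count-≤-fibres {a} {b} {c} p q f f∈q fibre≤c = begin
  count p                           ≡⟨ count-fibres p f ⟩
  ∑[ u < b ] count (fibre p f u)    ≤⟨ sum-mono-≤ fibre≤𝟙q*c ⟩
  ∑[ u < b ] (𝟙 (q u) * c)          ≡⟨ sum-*ʳ (𝟙 ∘ q) c ⟩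
  count q * c                       ∎
  where
  open ≤-Reasoning
  fibre≤𝟙q*c : ∀ u → count (fibre p f u) ≤ 𝟙 (q u) * c
  fibre≤𝟙q*c u with q u in qu
  ... | true  = subst (count (fibre p f u) ≤_) (sym (+-identityʳ c)) (fibre≤c u)
  ... | false = ¬injection⇒count-≤ {p = fibre p f u} λ ℓ _ ℓ∈fibre →
    let pv , fv≡u = fibre⁻ {p = p} {f} (ℓ∈fibre zero) in
    subst T qu (subst (T ∘ q) fv≡u (f∈q _ pv))

injective⇒≤-count : ∀ {m n} {p : Fin n → Bool} (ℓ : Fin m → Fin n) →
                    Injective _≡_ _≡_ ℓ → (∀ i → T (p (ℓ i))) → m ≤ count p
injective⇒≤-count {m} {n} {p} ℓ ℓ-inj ℓ∈p = begin
  m                         ≡⟨ count-true m ⟨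
  count {m} (λ _ → true)    ≤⟨ count-≤-fibres (λ _ → true) p ℓ (λ i _ → ℓ∈p i) fibre≤1 ⟩
  count p * 1               ≡⟨ *-identityʳ (count p) ⟩
  count p                   ∎
  where
  open ≤-Reasoning
  fibre≤1 : ∀ u → count (fibre (λ _ → true) ℓ u) ≤ 1
  fibre≤1 u = count-≤1 {p = fibre (λ _ → true) ℓ u} λ i∈fibre j∈fibre →
    ℓ-inj (trans (proj₂ (fibre⁻ {p = λ _ → true} {ℓ} i∈fibre))
                 (sym (proj₂ (fibre⁻ {p = λ _ → true} {ℓ} j∈fibre))))

remQuot-injective : ∀ {m} d {i j : Fin (m * d)} → remQuot {m} d i ≡ remQuot d j → i ≡ j
remQuot-injective {m} d {i} {j} same =
  trans (sym (combine-remQuot {m} d i)) (trans (cong (uncurry (combine {m} {d})) same) (combine-remQuot {m} d j))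

-- Graphs

Adj-sym : ∀ {n} (G : Graph n) {u v} → Adj G u v → Adj G v u
Adj-sym G {u} {v} = subst T (adj-sym G u v)

Adj-irrefl : ∀ {n} (G : Graph n) {u} → ¬ Adj G u u
Adj-irrefl G {u} = subst T (irrefl G u)

∈⇒T : ∀ {n} {S : Subset n} {u} → u ∈ S → T (lookup S u)
∈⇒T u∈S = T-≡ .from ([]=⇒lookup u∈S)

module _ {n} {G : Graph n} {P : Fin n → Set} where

  path-start : ∀ {u v} → PathIn G P u v → P u
  path-start (here pu)     = pu
  path-start (step pu _ _) = pu

  _++ᵖ_ : ∀ {u v w} → PathIn G P u v → PathIn G P v w → PathIn G P u w
  here _      ++ᵖ q = q
  step pu a p ++ᵖ q = step pu a (p ++ᵖ q)

  reverse : ∀ {u v} → PathIn G P u v → PathIn G P v u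
  reverse (here pu)     = here pu
  reverse (step pu a p) = reverse p ++ᵖ step (path-start p) (Adj-sym G a) (here pu)

earlier-neighbours⇒ValidOrder : ∀ {n} (G : Graph n) →
  (∀ v → 0 ℕ.< toℕ v → ∃ λ w → w < v × Adj G w v) → ValidOrder G
earlier-neighbours⇒ValidOrder {zero}  G _       i _ ()
earlier-neighbours⇒ValidOrder {suc n} G earlier i _ u v u<i v<i =
  path-to-zero u (<-wellFounded u) u<i ++ᵖ reverse (path-to-zero v (<-wellFounded v) v<i)
  where
  path-to-zero : ∀ v → Acc _<_ v → toℕ v ℕ.< i → PathIn G (Prefix i) v zero
  path-to-zero zero      _         v<i = here v<i
  path-to-zero v@(suc _) (acc rec) v<i with w , w<v , w~v ← earlier v z<s =
    step v<i (Adj-sym G w~v) (path-to-zero w (rec w<v) (<-trans w<v v<i))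

cliqueCover⇒K1tFree : ∀ {n r} (G : Graph n) →
  (∀ c → Σ (∀ u → Adj G c u → Fin r) λ colour →
     ∀ {u w} (c~u : Adj G c u) (c~w : Adj G c w) → colour u c~u ≡ colour w c~w → u ≡ w ⊎ Adj G u w) →
  K1tFree (suc r) G
cliqueCover⇒K1tFree {r = r} G cover (c , ℓ , ℓ-inj , c~ℓ , ℓ-indep)
  with colour , clique ← cover c
  with i , j , i<j , same-colour ← pigeonhole (n<1+n r) (λ i → colour (ℓ i) (c~ℓ i)) =
  [ <⇒≢ i<j ∘ ℓ-inj , ℓ-indep i j (<⇒≢ i<j) ] (clique (c~ℓ i) (c~ℓ j) same-colour)

packing⇒≤-dominating : ∀ {m n} (G : Graph n) (ℓ : Fin m → Fin n) →
  (∀ {i j u} → InClosedNbhd G u (ℓ i) → InClosedNbhd G u (ℓ j) → i ≡ j) →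
  ∀ {D} → Dominating G D → m ≤ ∣ D ∣
packing⇒≤-dominating {m} {n} G ℓ disjoint {D} dom =
  subst (m ≤_) (sym (∣∣≡count D))
    (injective⇒≤-count dominator dominator-inj (λ i → ∈⇒T (proj₁ (proj₂ (dom (ℓ i))))))
  where
  dominator : Fin m → Fin n
  dominator i = proj₁ (dom (ℓ i))
  dominates : ∀ i → InClosedNbhd G (dominator i) (ℓ i)
  dominates i = proj₂ (proj₂ (dom (ℓ i)))
  dominator-inj : Injective _≡_ _≡_ dominator
  dominator-inj {i} {j} same = disjoint (dominates i) (subst (λ u → InClosedNbhd G u (ℓ j)) (sym same) (dominates j))

Independent : ∀ {n} → Graph n → (Fin n → Bool) → Set
Independent G S = ∀ {u v} → T (S u) → T (S v) → ¬ Adj G u v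

independent-family⊈closedNbhd : ∀ {n c} {G : Graph n} {S : Fin n → Bool} →
  K1tFree (suc (suc c)) G → Independent G S → ∀ u (ℓ : Fin (suc (suc c)) → Fin n) →
  Injective _≡_ _≡_ ℓ → (∀ i → T (S (ℓ i))) → ¬ (∀ i → InClosedNbhd G u (ℓ i))
independent-family⊈closedNbhd {G = G} {S} free indep u ℓ ℓ-inj ℓ∈S u≈ℓ with any? (λ i → ℓ i ≟ u)
... | yes (i , ℓi≡u) =
  [ (λ u≡ℓj → punchInᵢ≢i i zero (ℓ-inj (trans (sym u≡ℓj) (sym ℓi≡u))))
  , indep (subst (T ∘ S) ℓi≡u (ℓ∈S i)) (ℓ∈S j)
  ] (u≈ℓ j)
  where j = punchIn i zero
... | no ∄i = free (u , ℓ , ℓ-inj , u~ℓ , λ i j _ → indep (ℓ∈S i) (ℓ∈S j))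
  where
  u~ℓ : ∀ i → Adj G u (ℓ i)
  u~ℓ i = [ (λ u≡ℓi → ⊥-elim (∄i (i , sym u≡ℓi))) , id ] (u≈ℓ i)

independent≤dominating : ∀ {n c} {G : Graph n} {S : Fin n → Bool} {D} →
  K1tFree (suc (suc c)) G → Independent G S → Dominating G D → count S ≤ ∣ D ∣ * suc c
independent≤dominating {n} {c} {G} {S} {D} free indep dom = begin
  count S                   ≤⟨ count-≤-fibres S (lookup D) dominator dominator∈D fibre≤ ⟩
  count (lookup D) * suc c  ≡⟨ cong (_* suc c) (∣∣≡count D) ⟨
  ∣ D ∣ * suc c             ∎
  where
  open ≤-Reasoning
  dominator : Fin n → Fin n
  dominator v = proj₁ (dom v)
  dominator∈D : ∀ v → T (S v) → T (lookup D (dominator v))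
  dominator∈D v _ = ∈⇒T (proj₁ (proj₂ (dom v)))
  fibre≤ : ∀ u → count (fibre S dominator u) ≤ suc c
  fibre≤ u = ¬injection⇒count-≤ {p = fibre S dominator u} λ ℓ ℓ-inj ℓ∈fibre →
    independent-family⊈closedNbhd {c = c} {G} {S} free indep u ℓ ℓ-inj
      (λ i → proj₁ (fibre⁻ {p = S} {dominator} (ℓ∈fibre i)))
      (λ i → subst (λ w → InClosedNbhd G w (ℓ i)) (proj₂ (fibre⁻ {p = S} {dominator} (ℓ∈fibre i)))
                   (proj₂ (proj₂ (dom (ℓ i)))))

-- The greedy algorithm

foldl-allFin-induction : ∀ {n} {B : Set} (P : ℕ → B → Set) (f : B → Fin n → B) {z : B} →
  P 0 z → (∀ b x → P (toℕ x) b → P (suc (toℕ x)) (f b x)) → P n (foldl f z (allFin n))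
foldl-allFin-induction {n} {B} P f {z} P₀ preserved = go n id 0 z (λ _ → refl) P₀
  where
  go : ∀ m (g : Fin m → Fin n) j b → (∀ i → toℕ (g i) ≡ j + toℕ i) → P j b →
       P (j + m) (foldl f b (List.tabulate g))
  go zero    g j b _  Pjb = subst (λ k → P k b) (sym (+-identityʳ j)) Pjb
  go (suc m) g j b g≡ Pjb =
    subst (λ k → P k (foldl f (f b (g zero)) (List.tabulate (g ∘ suc)))) (sym (+-suc j m))
      (go m (g ∘ suc) (suc j) (f b (g zero)) (λ i → trans (g≡ (suc i)) (+-suc j (toℕ i)))
        (subst (λ k → P (suc k) (f b (g zero))) g₀≡j
          (preserved b (g zero) (subst (λ k → P k b) (sym g₀≡j) Pjb))))
    where
    g₀≡j : toℕ (g zero) ≡ j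
    g₀≡j = trans (g≡ zero) (+-identityʳ j)

module _ {n} (G : Graph n) where

  dominatedB-sound : ∀ S {v} → T (dominatedB G S v) → ∃ λ u → T (lookup S u) × InClosedNbhd G u v
  dominatedB-sound S {v} dominated
    with u , u∈S∧u≈v ← satisfied (any⁻ _ (allFin n) dominated)
    with u∈S , u≈v ← T-∧ .to u∈S∧u≈v =
    u , u∈S , Sum.map₁ (does-sound (u ≟ v)) (T-∨ .to u≈v)

  dominatedB-complete : ∀ S {u v} → T (lookup S u) → InClosedNbhd G u v → T (dominatedB G S v)
  dominatedB-complete S {u} {v} u∈S u≈v =
    any⁺ _ (tabulate⁺ u (T-∧ .from (u∈S , T-∨ .from (Sum.map₁ (does-complete (u ≟ v)) u≈v))))

  UndominatedByEarlier : (Fin n → Bool) → Fin n → Set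
  UndominatedByEarlier S v = ∀ u → u < v → T (S u) → ¬ Adj G u v

  undominated-cong : ∀ S S′ {v} → (∀ {u} → u < v → S u ≡ S′ u) →
                     UndominatedByEarlier S v → UndominatedByEarlier S′ v
  undominated-cong S S′ S≡S′ und u u<v = und u u<v ∘ subst T (sym (S≡S′ u<v))

  greedy-step : Subset n → Fin n → Subset n
  greedy-step S v = if dominatedB G S v then S else (S [ v ]≔ true)

  GreedyInvariant : ℕ → Subset n → Set
  GreedyInvariant j S = (∀ v → T (lookup S v) → toℕ v ℕ.< j)
                      × (∀ v → toℕ v ℕ.< j → T (lookup S v) ⇔ UndominatedByEarlier (lookup S) v)

  dominated-step : ∀ S {x} → T (dominatedB G S x) →
                   GreedyInvariant (toℕ x) S → GreedyInvariant (suc (toℕ x)) S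
  dominated-step S {x} dominated (S<x , S⇔und) = m<n⇒m<1+n ∘₂ S<x , S⇔und′
    where
    S⇔und′ : ∀ v → toℕ v ℕ.< suc (toℕ x) → T (lookup S v) ⇔ UndominatedByEarlier (lookup S) v
    S⇔und′ v v<1+x with m<1+n⇒m<n∨m≡n v<1+x
    ... | inj₁ v<x = S⇔und v v<x
    ... | inj₂ v≡x
      with refl ← toℕ-injective v≡x
      with u , u∈S , u≈x ← dominatedB-sound S dominated =
      mk⇔ (λ x∈S → ⊥-elim (<-irrefl refl (S<x x x∈S)))
          (λ und → ⊥-elim ([ (λ u≡x → <-irrefl (cong toℕ u≡x) (S<x u u∈S))
                           , und u (S<x u u∈S) u∈S ] u≈x))

  undominated-step : ∀ S {x} → ¬ T (dominatedB G S x) →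
                     GreedyInvariant (toℕ x) S → GreedyInvariant (suc (toℕ x)) (S [ x ]≔ true)
  undominated-step S {x} undominated (S<x , S⇔und) = S′<1+x , S′⇔und
    where
    S′ : Subset n
    S′ = S [ x ]≔ true
    S′≡S : ∀ {v} → v < x → lookup S′ v ≡ lookup S v
    S′≡S v<x = lookup∘update′ (<⇒≢ v<x) S true
    und-S⇔S′ : ∀ {v} → toℕ v ≤ toℕ x →
               UndominatedByEarlier (lookup S) v ⇔ UndominatedByEarlier (lookup S′) v
    und-S⇔S′ v≤x = mk⇔ (undominated-cong (lookup S) (lookup S′) λ u<v → sym (S′≡S (<-≤-trans u<v v≤x)))
                       (undominated-cong (lookup S′) (lookup S) λ u<v → S′≡S (<-≤-trans u<v v≤x))
    S′<1+x : ∀ v → T (lookup S′ v) → toℕ v ℕ.< suc (toℕ x)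
    S′<1+x v v∈S′ with v ≟ x
    ... | yes refl = n<1+n (toℕ x)
    ... | no  v≢x  = m<n⇒m<1+n (S<x v (subst T (lookup∘update′ v≢x S true) v∈S′))
    S′⇔und : ∀ v → toℕ v ℕ.< suc (toℕ x) → T (lookup S′ v) ⇔ UndominatedByEarlier (lookup S′) v
    S′⇔und v v<1+x with m<1+n⇒m<n∨m≡n v<1+x
    ... | inj₁ v<x = mk⇔
      (und-S⇔S′ (<⇒≤ v<x) .to ∘ S⇔und v v<x .to ∘ subst T (S′≡S v<x))
      (subst T (sym (S′≡S v<x)) ∘ S⇔und v v<x .from ∘ und-S⇔S′ (<⇒≤ v<x) .from)
    ... | inj₂ v≡x with refl ← toℕ-injective v≡x = mk⇔
      (λ _ → und-S⇔S′ ≤-refl .to λ u u<x u∈S u~x → undominated (dominatedB-complete S u∈S (inj₂ u~x)))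
      (λ _ → subst T (sym (lookup∘update x S true)) tt)

  greedy-invariant : GreedyInvariant n (greedy G)
  greedy-invariant = foldl-allFin-induction GreedyInvariant greedy-step (nothing-selected , λ _ ()) invariant-step
    where
    nothing-selected : ∀ v → T (lookup ∅ v) → toℕ v ℕ.< 0
    nothing-selected v v∈∅ = ⊥-elim (subst T (lookup-replicate v false) v∈∅)
    invariant-step : ∀ S x → GreedyInvariant (toℕ x) S → GreedyInvariant (suc (toℕ x)) (greedy-step S x)
    invariant-step S x inv with dominatedB G S x in d
    ... | true  = dominated-step S (T-≡ .from d) inv
    ... | false = undominated-step S (subst T d) inv

  greedy-spec : ∀ v → T (lookup (greedy G) v) ⇔ UndominatedByEarlier (lookup (greedy G)) v
  greedy-spec v = proj₂ greedy-invariant v (toℕ<n v)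

  greedy-independent : Independent G (lookup (greedy G))
  greedy-independent {u} {v} u∈greedy v∈greedy u~v with <-cmp u v
  ... | tri< u<v _ _  = greedy-spec v .to v∈greedy u u<v u∈greedy u~v
  ... | tri≈ _ refl _ = Adj-irrefl G u~v
  ... | tri> _ _ v<u  = greedy-spec u .to u∈greedy v v<u v∈greedy (Adj-sym G u~v)

  greedy-unique : (S : Fin n → Bool) → Independent G S →
                  (∀ v → ¬ T (S v) → ∃ λ w → w < v × T (S w) × Adj G w v) →
                  ∀ v → lookup (greedy G) v ≡ S v
  greedy-unique S indep earlier v = go v (<-wellFounded v)
    where
    go : ∀ v → Acc _<_ v → lookup (greedy G) v ≡ S v
    go v (acc rec) with S v in Sv
    ... | true  = T-≡ .to (greedy-spec v .from λ u u<v u∈greedy →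
                    indep (subst T (go u (rec u<v)) u∈greedy) (T-≡ .from Sv))
    ... | false = ¬-not λ v∈greedy →
      let w , w<v , w∈S , w~v = earlier v (subst T Sv) in
      greedy-spec v .to (T-≡ .from v∈greedy) w w<v (subst T (sym (go w (rec w<v))) w∈S) w~v

greedy-approximation : ∀ {n c} {G : Graph n} {D} → K1tFree (suc (suc c)) G → Dominating G D →
                       ALG G ≤ ∣ D ∣ * suc c
greedy-approximation {c = c} {G} {D} free dom =
  subst (_≤ ∣ D ∣ * suc c) (sym (∣∣≡count (greedy G)))
    (independent≤dominating {c = c} {G} {lookup (greedy G)} free (greedy-independent G) dom)

-- The lower-bound construction

module GadgetChain (s k : ℕ) where

  Position : Set
  Position = Fin (4 + s)

  pattern entry  = zero
  pattern centre = suc zero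
  pattern exit   = suc (suc zero)
  pattern leaf r = suc (suc (suc r))

  data Edge : ℕ → Position → ℕ → Position → Set where
    entry-centre : ∀ {j} → Edge j entry j centre
    entry-exit   : ∀ {j} → Edge j entry j exit
    centre-exit  : ∀ {j} → Edge j centre j exit
    centre-leaf  : ∀ {j} r → Edge j centre j (leaf r)
    exit-entry   : ∀ {j} → Edge j exit (suc j) entry

  edge? : ∀ i p j q → Dec (Edge i p j q)
  edge? i entry    j entry    = no λ ()
  edge? i entry    j centre   = map′ (λ { refl → entry-centre }) (λ { entry-centre → refl }) (i ℕ.≟ j)
  edge? i entry    j exit     = map′ (λ { refl → entry-exit }) (λ { entry-exit → refl }) (i ℕ.≟ j)
  edge? i entry    j (leaf _) = no λ ()
  edge? i centre   j entry    = no λ ()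
  edge? i centre   j centre   = no λ ()
  edge? i centre   j exit     = map′ (λ { refl → centre-exit }) (λ { centre-exit → refl }) (i ℕ.≟ j)
  edge? i centre   j (leaf r) = map′ (λ { refl → centre-leaf r }) (λ { (centre-leaf _) → refl }) (i ℕ.≟ j)
  edge? i exit     j entry    = map′ (λ { refl → exit-entry }) (λ { exit-entry → refl }) (suc i ℕ.≟ j)
  edge? i exit     j centre   = no λ ()
  edge? i exit     j exit     = no λ ()
  edge? i exit     j (leaf _) = no λ ()
  edge? i (leaf _) j _        = no λ ()

  Adjacent : ℕ → Position → ℕ → Position → Set
  Adjacent i p j q = Edge i p j q ⊎ Edge j q i p

  adjacent? : ∀ i p j q → Dec (Adjacent i p j q)
  adjacent? i p j q = edge? i p j q ⊎-dec edge? j q i p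

  ¬Adjacent-refl : ∀ j p → ¬ Adjacent j p j p
  ¬Adjacent-refl j p (inj₁ ())
  ¬Adjacent-refl j p (inj₂ ())

  n : ℕ
  n = k * (4 + s)

  decode : Fin n → Fin k × Position
  decode = remQuot (4 + s)

  gadget : Fin n → ℕ
  gadget v = toℕ (proj₁ (decode v))

  pos : Fin n → Position
  pos v = proj₂ (decode v)

  vertex : Fin k → Position → Fin n
  vertex = combine

  G : Graph n
  G = record
    { adj    = λ u v → does (adjacent? (gadget u) (pos u) (gadget v) (pos v))
    ; sym    = λ u v → ∨-comm (does (edge? (gadget u) (pos u) (gadget v) (pos v))) _
    ; irrefl = λ u → dec-false (adjacent? (gadget u) (pos u) (gadget u) (pos u)) (¬Adjacent-refl (gadget u) (pos u))
    }

  Adj⇒Adjacent : ∀ {u v} → Adj G u v → Adjacent (gadget u) (pos u) (gadget v) (pos v)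
  Adj⇒Adjacent {u} {v} = does-sound (adjacent? (gadget u) (pos u) (gadget v) (pos v))

  Adjacent⇒Adj : ∀ {u v} → Adjacent (gadget u) (pos u) (gadget v) (pos v) → Adj G u v
  Adjacent⇒Adj {u} {v} = does-complete (adjacent? (gadget u) (pos u) (gadget v) (pos v))

  decode-vertex : ∀ b p → decode (vertex b p) ≡ (b , p)
  decode-vertex = remQuot-combine

  pos-vertex : ∀ b p → pos (vertex b p) ≡ p
  pos-vertex b p = cong proj₂ (decode-vertex b p)

  decode-injective : ∀ {u v} → decode u ≡ decode v → u ≡ v
  decode-injective = remQuot-injective {k} (4 + s)

  Adjacent⇒Adj-vertex : ∀ {b p b′ q} → Adjacent (toℕ b) p (toℕ b′) q → Adj G (vertex b p) (vertex b′ q)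
  Adjacent⇒Adj-vertex {b} {p} {b′} {q} =
    Adjacent⇒Adj ∘ subst₂ (λ x y → Adjacent (toℕ (proj₁ x)) (proj₂ x) (toℕ (proj₁ y)) (proj₂ y))
                          (sym (decode-vertex b p)) (sym (decode-vertex b′ q))

  data View : Fin n → Set where
    ⟨_,_⟩ : ∀ b p → View (vertex b p)

  view : ∀ v → View v
  view v = subst View (combine-remQuot {k} (4 + s) v) ⟨ proj₁ (decode v) , pos v ⟩

  vertex-monoʳ-< : ∀ b {p q} → p < q → vertex b p < vertex b q
  vertex-monoʳ-< b {p} {q} p<q =
    subst₂ ℕ._<_ (sym (toℕ-combine b p)) (sym (toℕ-combine b q)) (+-monoʳ-< ((4 + s) * toℕ b) p<q)

  earlier-neighbour : ∀ v → 0 ℕ.< toℕ v → ∃ λ w → w < v × Adj G w v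
  earlier-neighbour v 0<v with view v
  ... | ⟨ zero  , entry ⟩ = ⊥-elim (n≮0 0<v)
  ... | ⟨ suc b , entry ⟩ =
    vertex (inject₁ b) exit , combine-monoˡ-< {i = inject₁ b} {suc b} exit entry (≤̄⇒inject₁< {i = b} ≤-refl) ,
    Adjacent⇒Adj-vertex (inj₁ (subst (λ j → Edge j exit (suc (toℕ b)) entry) (sym (toℕ-inject₁ b)) exit-entry))
  ... | ⟨ b , centre ⟩ = vertex b entry  , vertex-monoʳ-< b z<s       , Adjacent⇒Adj-vertex (inj₁ entry-centre)
  ... | ⟨ b , exit   ⟩ = vertex b entry  , vertex-monoʳ-< b z<s       , Adjacent⇒Adj-vertex (inj₁ entry-exit)
  ... | ⟨ b , leaf r ⟩ = vertex b centre , vertex-monoʳ-< b (s<s z<s) , Adjacent⇒Adj-vertex (inj₁ (centre-leaf r))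

  valid-order : ValidOrder G
  valid-order = earlier-neighbours⇒ValidOrder G earlier-neighbour

  -- Colour 0 is the rest of the triangle, colour 1 the neighbour in the adjacent gadget, and every
  -- leaf of a centre gets its own colour; leaf 0 may share colour 1 because a centre has no
  -- neighbour outside its gadget.
  colour : ∀ {jc pc ju pu} → Adjacent jc pc ju pu → Fin (2 + s)
  colour (inj₂ exit-entry)      = suc zero
  colour (inj₁ exit-entry)      = suc zero
  colour (inj₁ (centre-leaf r)) = suc r
  colour _                      = zero

  same-colour⇒clique : ∀ {jc pc ju pu jw pw} (c~u : Adjacent jc pc ju pu) (c~w : Adjacent jc pc jw pw) →
                       colour c~u ≡ colour c~w → (ju ≡ jw × pu ≡ pw) ⊎ Adjacent ju pu jw pw
  same-colour⇒clique (inj₁ entry-centre)    (inj₁ entry-centre)    _    = inj₁ (refl , refl)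
  same-colour⇒clique (inj₁ entry-centre)    (inj₁ entry-exit)      _    = inj₂ (inj₁ centre-exit)
  same-colour⇒clique (inj₁ entry-centre)    (inj₂ exit-entry)      ()
  same-colour⇒clique (inj₁ entry-exit)      (inj₁ entry-centre)    _    = inj₂ (inj₂ centre-exit)
  same-colour⇒clique (inj₁ entry-exit)      (inj₁ entry-exit)      _    = inj₁ (refl , refl)
  same-colour⇒clique (inj₁ entry-exit)      (inj₂ exit-entry)      ()
  same-colour⇒clique (inj₂ exit-entry)      (inj₁ entry-centre)    ()
  same-colour⇒clique (inj₂ exit-entry)      (inj₁ entry-exit)      ()
  same-colour⇒clique (inj₂ exit-entry)      (inj₂ exit-entry)      _    = inj₁ (refl , refl)
  same-colour⇒clique (inj₂ entry-centre)    (inj₂ entry-centre)    _    = inj₁ (refl , refl)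
  same-colour⇒clique (inj₂ entry-centre)    (inj₁ centre-exit)     _    = inj₂ (inj₁ entry-exit)
  same-colour⇒clique (inj₂ entry-centre)    (inj₁ (centre-leaf _)) ()
  same-colour⇒clique (inj₁ centre-exit)     (inj₂ entry-centre)    _    = inj₂ (inj₂ entry-exit)
  same-colour⇒clique (inj₁ centre-exit)     (inj₁ centre-exit)     _    = inj₁ (refl , refl)
  same-colour⇒clique (inj₁ centre-exit)     (inj₁ (centre-leaf _)) ()
  same-colour⇒clique (inj₁ (centre-leaf _)) (inj₂ entry-centre)    ()
  same-colour⇒clique (inj₁ (centre-leaf _)) (inj₁ centre-exit)     ()
  same-colour⇒clique (inj₁ (centre-leaf _)) (inj₁ (centre-leaf _)) r≡r′ =
    inj₁ (refl , cong leaf (suc-injective r≡r′))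
  same-colour⇒clique (inj₂ entry-exit)      (inj₂ entry-exit)      _    = inj₁ (refl , refl)
  same-colour⇒clique (inj₂ entry-exit)      (inj₂ centre-exit)     _    = inj₂ (inj₁ entry-centre)
  same-colour⇒clique (inj₂ entry-exit)      (inj₁ exit-entry)      ()
  same-colour⇒clique (inj₂ centre-exit)     (inj₂ entry-exit)      _    = inj₂ (inj₂ entry-centre)
  same-colour⇒clique (inj₂ centre-exit)     (inj₂ centre-exit)     _    = inj₁ (refl , refl)
  same-colour⇒clique (inj₂ centre-exit)     (inj₁ exit-entry)      ()
  same-colour⇒clique (inj₁ exit-entry)      (inj₂ entry-exit)      ()
  same-colour⇒clique (inj₁ exit-entry)      (inj₂ centre-exit)     ()
  same-colour⇒clique (inj₁ exit-entry)      (inj₁ exit-entry)      _    = inj₁ (refl , refl)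
  same-colour⇒clique (inj₂ (centre-leaf _)) (inj₂ (centre-leaf _)) _    = inj₁ (refl , refl)

  claw-free : K1tFree (3 + s) G
  claw-free = cliqueCover⇒K1tFree G λ c →
    (λ u → colour ∘ Adj⇒Adjacent {c} {u}) ,
    λ {u} {w} c~u c~w same →
      Sum.map (λ (b≡ , p≡) → decode-injective (cong₂ _,_ (toℕ-injective b≡) p≡)) Adjacent⇒Adj
              (same-colour⇒clique (Adj⇒Adjacent {c} {u} c~u) (Adj⇒Adjacent {c} {w} c~w) same)

  selected : Position → Bool
  selected entry    = true
  selected centre   = false
  selected exit     = false
  selected (leaf _) = true

  selected-pos-vertex : ∀ b {p} → T (selected p) → T (selected (pos (vertex b p)))
  selected-pos-vertex b {p} = subst (T ∘ selected) (sym (pos-vertex b p))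

  Edge⇒unselected : ∀ {i p j q} → Edge i p j q → T (selected p) → T (selected q) → ⊥
  Edge⇒unselected entry-centre    _  ()
  Edge⇒unselected entry-exit      _  ()
  Edge⇒unselected centre-exit     () _
  Edge⇒unselected (centre-leaf _) () _
  Edge⇒unselected exit-entry      () _

  selected-independent : Independent G (selected ∘ pos)
  selected-independent {u} {v} u∈ v∈ u~v =
    [ (λ e → Edge⇒unselected e u∈ v∈) , (λ e → Edge⇒unselected e v∈ u∈) ] (Adj⇒Adjacent {u} {v} u~v)

  unselected⇒earlier-selected : ∀ v → ¬ T (selected (pos v)) →
                                ∃ λ w → w < v × T (selected (pos w)) × Adj G w v
  unselected⇒earlier-selected v unselected with view v
  ... | ⟨ b , entry  ⟩ = ⊥-elim (unselected (selected-pos-vertex b tt))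
  ... | ⟨ b , leaf _ ⟩ = ⊥-elim (unselected (selected-pos-vertex b tt))
  ... | ⟨ b , centre ⟩ =
    vertex b entry , vertex-monoʳ-< b z<s , selected-pos-vertex b tt , Adjacent⇒Adj-vertex (inj₁ entry-centre)
  ... | ⟨ b , exit   ⟩ =
    vertex b entry , vertex-monoʳ-< b z<s , selected-pos-vertex b tt , Adjacent⇒Adj-vertex (inj₁ entry-exit)

  greedy≡selected : ∀ v → lookup (greedy G) v ≡ selected (pos v)
  greedy≡selected = greedy-unique G (selected ∘ pos) selected-independent unselected⇒earlier-selected

  selected-position : Fin (2 + s) → Position
  selected-position zero    = entry
  selected-position (suc r) = leaf r

  selected-position-selected : ∀ r → T (selected (selected-position r))
  selected-position-selected zero    = tt
  selected-position-selected (suc r) = tt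

  selected-position-injective : Injective _≡_ _≡_ selected-position
  selected-position-injective {zero}  {zero}   _     = refl
  selected-position-injective {suc r} {suc r′} leaf≡ = cong suc (suc-injective (suc-injective (suc-injective leaf≡)))

  selection-index : Fin (k * (2 + s)) → Fin k × Fin (2 + s)
  selection-index = remQuot (2 + s)

  enumerate-selected : Fin (k * (2 + s)) → Fin n
  enumerate-selected i = vertex (proj₁ (selection-index i)) (selected-position (proj₂ (selection-index i)))

  enumerate-selected-injective : Injective _≡_ _≡_ enumerate-selected
  enumerate-selected-injective {i} {j} same = remQuot-injective {k} (2 + s) (cong₂ _,_
    (combine-injectiveˡ (proj₁ (selection-index i)) _ (proj₁ (selection-index j)) _ same)
    (selected-position-injective (combine-injectiveʳ (proj₁ (selection-index i)) _ (proj₁ (selection-index j)) _ same)))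

  k*[2+s]≤ALG : k * (2 + s) ≤ ALG G
  k*[2+s]≤ALG = subst (k * (2 + s) ≤_) (sym (∣∣≡count (greedy G)))
    (injective⇒≤-count enumerate-selected enumerate-selected-injective λ i →
      subst T (sym (greedy≡selected (enumerate-selected i)))
              (selected-pos-vertex _ (selected-position-selected (proj₂ (selection-index i)))))

  isCentre : Fin n → Bool
  isCentre v = does (pos v ≟ centre)

  centres : Subset n
  centres = tabulate isCentre

  centres-dominating : Dominating G centres
  centres-dominating v with view v
  ... | ⟨ b , p ⟩ = vertex b centre , centre∈centres , centre-dominates p
    where
    centre∈centres : vertex b centre ∈ centres
    centre∈centres = lookup⇒[]= _ centres
      (trans (lookup∘tabulate isCentre _) (dec-true (pos (vertex b centre) ≟ centre) (pos-vertex b centre)))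
    centre-dominates : ∀ p → InClosedNbhd G (vertex b centre) (vertex b p)
    centre-dominates entry    = inj₂ (Adjacent⇒Adj-vertex (inj₂ entry-centre))
    centre-dominates centre   = inj₁ refl
    centre-dominates exit     = inj₂ (Adjacent⇒Adj-vertex (inj₁ centre-exit))
    centre-dominates (leaf r) = inj₂ (Adjacent⇒Adj-vertex (inj₁ (centre-leaf r)))

  ∣centres∣≤k : ∣ centres ∣ ≤ k
  ∣centres∣≤k = begin
    ∣ centres ∣                 ≡⟨ ∣∣≡count centres ⟩
    count (lookup centres)      ≤⟨ count-≤-fibres (lookup centres) (λ _ → true) (proj₁ ∘ decode)
                                                  (λ _ _ → tt) fibre≤1 ⟩
    count {k} (λ _ → true) * 1  ≡⟨ *-identityʳ _ ⟩
    count {k} (λ _ → true)      ≡⟨ count-true k ⟩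
    k                           ∎
    where
    open ≤-Reasoning
    is-centre : ∀ {v} → T (lookup centres v) → pos v ≡ centre
    is-centre {v} = does-sound (pos v ≟ centre) ∘ subst T (lookup∘tabulate isCentre v)
    fibre≤1 : ∀ b → count (fibre (lookup centres) (proj₁ ∘ decode) b) ≤ 1
    fibre≤1 b = count-≤1 {p = fibre (lookup centres) (proj₁ ∘ decode) b} λ u∈ v∈ →
      let u∈centres , gadget-u = fibre⁻ {p = lookup centres} {proj₁ ∘ decode} u∈
          v∈centres , gadget-v = fibre⁻ {p = lookup centres} {proj₁ ∘ decode} v∈
      in decode-injective (cong₂ _,_ (trans gadget-u (sym gadget-v))
                                     (trans (is-centre u∈centres) (sym (is-centre v∈centres))))

  Adjacent-leaf : ∀ {i p j r} → Adjacent i p j (leaf r) → i ≡ j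
  Adjacent-leaf (inj₁ (centre-leaf _)) = refl
  Adjacent-leaf (inj₂ ())

  closedNbhd-leaf : ∀ {u b r} → InClosedNbhd G u (vertex b (leaf r)) → proj₁ (decode u) ≡ b
  closedNbhd-leaf {b = b} {r} (inj₁ refl) = cong proj₁ (decode-vertex b (leaf r))
  closedNbhd-leaf {u} {b} {r} (inj₂ u~ℓ) = toℕ-injective (Adjacent-leaf
    (subst (λ x → Adjacent (gadget u) (pos u) (toℕ (proj₁ x)) (proj₂ x)) (decode-vertex b (leaf r))
           (Adj⇒Adjacent {u} {vertex b (leaf r)} u~ℓ)))

  k≤dominating : ∀ {D} → Dominating G D → k ≤ ∣ D ∣
  k≤dominating = packing⇒≤-dominating G (λ b → vertex b (leaf zero))
    (λ u≈ℓi u≈ℓj → trans (sym (closedNbhd-leaf u≈ℓi)) (closedNbhd-leaf u≈ℓj))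

  OPT≡k : IsOPT G k
  OPT≡k = (centres , centres-dominating , ≤-antisym ∣centres∣≤k (k≤dominating centres-dominating)) ,
          λ _ → k≤dominating

m*[k*c]≡c*m*k : ∀ m k c → m * (k * c) ≡ c * m * k
m*[k*c]≡c*m*k = solve-∀

ratio-upper : ∀ {a} c m k → a ≤ k * c → m * a ≤ (c * m + 1) * k
ratio-upper {a} c m k a≤kc = begin
  m * a            ≤⟨ *-monoʳ-≤ m a≤kc ⟩
  m * (k * c)      ≡⟨ m*[k*c]≡c*m*k m k c ⟩
  c * m * k        ≤⟨ m≤m+n (c * m * k) k ⟩
  c * m * k + k    ≡⟨ x*k+k≡[x+1]*k (c * m) k ⟩
  (c * m + 1) * k  ∎
  where
  open ≤-Reasoning
  x*k+k≡[x+1]*k : ∀ x k → x * k + k ≡ (x + 1) * k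
  x*k+k≡[x+1]*k = solve-∀

ratio-lower : ∀ {a} c m k → k * c ≤ a → c * m * k ≤ m * a + k
ratio-lower {a} c m k kc≤a = begin
  c * m * k    ≡⟨ m*[k*c]≡c*m*k m k c ⟨
  m * (k * c)  ≤⟨ *-monoʳ-≤ m kc≤a ⟩
  m * a        ≤⟨ m≤m+n (m * a) k ⟩
  m * a + k    ∎
  where open ≤-Reasoning

theorem8 : (t : ℕ) → 3 ≤ t →
    ((m : ℕ) → 1 ≤ m → Σ ℕ λ K →
        (n : ℕ) (G : Graph n) → ValidOrder G → K1tFree t G →
        (k : ℕ) → IsOPT G k → K ≤ k →
        m * ALG G ≤ ((t ∸ 1) * m + 1) * k)
    ×
    ((m : ℕ) → 1 ≤ m → (K : ℕ) →
        Σ ℕ λ n → Σ (Graph n) λ G → ValidOrder G × K1tFree t G ×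
        Σ ℕ λ k → IsOPT G k × K ≤ k ×
        ((t ∸ 1) * m * k ≤ m * ALG G + k))
theorem8 (suc (suc (suc s))) (s≤s (s≤s (s≤s z≤n))) = upper , lower
  where
  upper : (m : ℕ) → 1 ≤ m → Σ ℕ λ K → (n : ℕ) (G : Graph n) → ValidOrder G → K1tFree (3 + s) G →
          (k : ℕ) → IsOPT G k → K ≤ k → m * ALG G ≤ ((2 + s) * m + 1) * k
  upper m _ = 0 , λ n G _ free k ((D , dom , ∣D∣≡k) , _) _ →
    ratio-upper (2 + s) m k
      (subst (λ d → ALG G ≤ d * (2 + s)) ∣D∣≡k (greedy-approximation {c = suc s} {G = G} free dom))
  lower : (m : ℕ) → 1 ≤ m → (K : ℕ) → Σ ℕ λ n → Σ (Graph n) λ G → ValidOrder G × K1tFree (3 + s) G ×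
          Σ ℕ λ k → IsOPT G k × K ≤ k × ((2 + s) * m * k ≤ m * ALG G + k)
  lower m _ K = n , G , valid-order , claw-free , K , OPT≡k , ≤-refl , ratio-lower (2 + s) m K k*[2+s]≤ALG
    where open GadgetChain s K
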